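{- Let $\Omega_H$ be the infinite hexagonal (honeycomb) lattice graph, i.e. the $3$-regular infinite planar graph whose faces are all hexagons. Then $\chi_{td}(\Omega_H)=7$.
   Context: For a (possibly infinite) graph $G$ and a positive integer $k$, a proper $k$-total difference labeling of $G$ is a function $f$ from $V(G)\cup E(G)$ to $\{1,2,\dots,k\}$ such that: (1) for every edge $\{u,v\}$, $f(\{u,v\})=|f(u)-f(v)|$; (2) adjacent vertices receive different labels; (3) two edges sharing a vertex receive different labels; (4) no edge receives the same label as one of its endpoints. $\chi_{td}(G)$ denotes the smallest $k$ for which $G$ has a proper $k$-total difference labeling. -}

module Defs where

open import Data.Nat using (ℕ; _≤_; _<_; ∣_-_∣)
open import Data.Integer using (ℤ; _-_; 1ℤ)
open import Data.Bool using (Bool; true; false)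
open import Data.Product using (_×_; _,_; ∃)
open import Data.Sum using (_⊎_)
open import Data.Empty using (⊥)
open import Relation.Binary.PropositionalEquality using (_≡_; _≢_)

-- Vertices of the honeycomb lattice Ω_H: two sublattices (true = "A", false = "B"),
-- each indexed by ℤ × ℤ.
V : Set
V = ℤ × ℤ × Bool

data HexEdge : V → V → Set where
  e₀ : ∀ i j → HexEdge (i , j , true) (i , j , false)
  e₁ : ∀ i j → HexEdge (i , j , true) (i - 1ℤ , j , false)
  e₂ : ∀ i j → HexEdge (i , j , true) (i , j - 1ℤ , false)

Adj : V → V → Set
Adj u v = HexEdge u v ⊎ HexEdge v u

-- Proper k-total difference labeling of Ω_H, given by its vertex part f;
-- the edge label of {u,v} is forced to be ∣ f u - f v ∣.
record IsProperTDL (k : ℕ) (f : V → ℕ) : Set where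
  field
    vertex-range : ∀ v → 1 ≤ f v × f v ≤ k
    edge-range   : ∀ u v → Adj u v → 1 ≤ ∣ f u - f v ∣ × ∣ f u - f v ∣ ≤ k
    adj-vertices : ∀ u v → Adj u v → f u ≢ f v
    adj-edges    : ∀ v u w → Adj v u → Adj v w → u ≢ w →
                   ∣ f v - f u ∣ ≢ ∣ f v - f w ∣
    edge-vs-end  : ∀ u v → Adj u v → ∣ f u - f v ∣ ≢ f u × ∣ f u - f v ∣ ≢ f v

HasProperTDL : ℕ → Set
HasProperTDL k = ∃ λ (f : V → ℕ) → IsProperTDL k f

χtd-Hex≡ : ℕ → Set
χtd-Hex≡ n = HasProperTDL n × (∀ k → k < n → HasProperTDL k → ⊥)

{-# OPTIONS --safe #-}
-- Upper bound: on each sublattice colour a vertex (i , j) by the residue of i - j mod 3;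
-- the three neighbours of any vertex then get the three distinct residues.  Labelling
-- A-vertices by 1, 2, 4 and B-vertices by 5, 6, 7 according to the residue, every edge is
-- admissible, and all A-labels lie below all B-labels, so distinct neighbour labels give
-- distinct edge labels.
--
-- Lower bound: with labels in {0, …, 6} a vertex of label a needs three admissible
-- neighbour labels with pairwise distinct differences to a.  A finite check shows that
-- the labels 0, 3, 2, 5, 1, 4, 6 can be excluded one after the other: once the earlier
-- ones are known to occur nowhere, no such triple of neighbour labels exists for the next.
module Submission where

open import Defs
open import Data.Bool using (Bool; true; false; not)
open import Data.Empty using (⊥; ⊥-elim)
open import Data.Integer using (ℤ; +_; -[1+_]; 0ℤ; 1ℤ)
open import Data.Integer.Tactic.RingSolver using (solve-∀)
import Data.Integer as ℤ
open import Data.List using (List; []; _∷_; upTo)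
open import Data.List.Membership.Propositional.Properties using (∈-upTo⁺)
open import Data.List.Relation.Unary.All as All using (All; all?)
open import Data.List.Relation.Unary.Any using (here; there)
open import Data.Nat using (ℕ; suc; _≤_; _<_; _∸_; _≤?_; ∣_-_∣; _≟_)
open import Data.Nat.Properties
  using (+-comm; +-identityʳ; ≤-trans; ≤-<-trans; m≤n⇒m≤1+n; ∣-∣-comm;
         m≤n⇒∣m-n∣≡n∸m; m≤n⇒∣n-m∣≡n∸m; ∸-cancelʳ-≡; ∸-cancelˡ-≡)
open import Data.List.Membership.DecPropositional _≟_ using (_∈_; _∉_; _∈?_)
open import Data.Product using (_×_; _,_; ∃; proj₁; proj₂)
open import Data.Sum using (inj₁; inj₂)
open import Data.Unit using (⊤; tt)
open import Relation.Nullary using (¬_; Dec; yes)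
open import Relation.Nullary.Decidable using (_×-dec_; ¬?; from-yes)
open import Relation.Binary.PropositionalEquality
open ≡-Reasoning

∣-∣-injectiveʳ-≥ : ∀ {a x y} → a ≤ x → a ≤ y → ∣ a - x ∣ ≡ ∣ a - y ∣ → x ≡ y
∣-∣-injectiveʳ-≥ {a} {x} {y} a≤x a≤y eq = ∸-cancelʳ-≡ a≤x a≤y (begin
  x ∸ a      ≡⟨ m≤n⇒∣m-n∣≡n∸m a≤x ⟨
  ∣ a - x ∣  ≡⟨ eq ⟩
  ∣ a - y ∣  ≡⟨ m≤n⇒∣m-n∣≡n∸m a≤y ⟩
  y ∸ a      ∎)

∣-∣-injectiveʳ-≤ : ∀ {a x y} → x ≤ a → y ≤ a → ∣ a - x ∣ ≡ ∣ a - y ∣ → x ≡ y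
∣-∣-injectiveʳ-≤ {a} {x} {y} x≤a y≤a eq = ∸-cancelˡ-≡ x≤a y≤a (begin
  a ∸ x      ≡⟨ m≤n⇒∣n-m∣≡n∸m x≤a ⟨
  ∣ a - x ∣  ≡⟨ eq ⟩
  ∣ a - y ∣  ≡⟨ m≤n⇒∣n-m∣≡n∸m y≤a ⟩
  a ∸ y      ∎)

data ℤ/3 : Set where
  r₀ r₁ r₂ : ℤ/3

suc₃ pred₃ : ℤ/3 → ℤ/3
suc₃ r₀ = r₁
suc₃ r₁ = r₂
suc₃ r₂ = r₀
pred₃ r₀ = r₂
pred₃ r₁ = r₀
pred₃ r₂ = r₁

suc₃-pred₃ : ∀ ρ → suc₃ (pred₃ ρ) ≡ ρ
suc₃-pred₃ r₀ = refl
suc₃-pred₃ r₁ = refl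
suc₃-pred₃ r₂ = refl

pred₃-suc₃ : ∀ ρ → pred₃ (suc₃ ρ) ≡ ρ
pred₃-suc₃ r₀ = refl
pred₃-suc₃ r₁ = refl
pred₃-suc₃ r₂ = refl

suc₃≢id : ∀ ρ → suc₃ ρ ≢ ρ
suc₃≢id r₀ ()
suc₃≢id r₁ ()
suc₃≢id r₂ ()

pred₃≢id : ∀ ρ → pred₃ ρ ≢ ρ
pred₃≢id r₀ ()
pred₃≢id r₁ ()
pred₃≢id r₂ ()

suc₃≢pred₃ : ∀ ρ → suc₃ ρ ≢ pred₃ ρ
suc₃≢pred₃ r₀ ()
suc₃≢pred₃ r₁ ()
suc₃≢pred₃ r₂ ()

mod3 : ℤ → ℤ/3
mod3 (+ 0)        = r₀
mod3 (+ suc n)    = suc₃ (mod3 (+ n))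
mod3 -[1+ 0 ]     = r₂
mod3 -[1+ suc n ] = pred₃ (mod3 -[1+ n ])

mod3[x+1]≡suc₃ : ∀ x → mod3 (x ℤ.+ 1ℤ) ≡ suc₃ (mod3 x)
mod3[x+1]≡suc₃ (+ n) rewrite +-comm n 1 = refl
mod3[x+1]≡suc₃ -[1+ 0 ]     = refl
mod3[x+1]≡suc₃ -[1+ suc n ] = sym (suc₃-pred₃ (mod3 -[1+ n ]))

mod3[x-1]≡pred₃ : ∀ x → mod3 (x ℤ.- 1ℤ) ≡ pred₃ (mod3 x)
mod3[x-1]≡pred₃ (+ 0)     = refl
mod3[x-1]≡pred₃ (+ suc n) = sym (pred₃-suc₃ (mod3 (+ n)))
mod3[x-1]≡pred₃ -[1+ n ] rewrite +-identityʳ n = refl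

[i-1]-j≡[i-j]-1 : ∀ i j → (i ℤ.- 1ℤ) ℤ.- j ≡ (i ℤ.- j) ℤ.- 1ℤ
[i-1]-j≡[i-j]-1 = solve-∀

i-[j-1]≡[i-j]+1 : ∀ i j → i ℤ.- (j ℤ.- 1ℤ) ≡ (i ℤ.- j) ℤ.+ 1ℤ
i-[j-1]≡[i-j]+1 = solve-∀

[i+1]-j≡[i-j]+1 : ∀ i j → (i ℤ.+ 1ℤ) ℤ.- j ≡ (i ℤ.- j) ℤ.+ 1ℤ
[i+1]-j≡[i-j]+1 = solve-∀

i-[j+1]≡[i-j]-1 : ∀ i j → i ℤ.- (j ℤ.+ 1ℤ) ≡ (i ℤ.- j) ℤ.- 1ℤ
i-[j+1]≡[i-j]-1 = solve-∀

[i-1]+1≡i : ∀ i → (i ℤ.- 1ℤ) ℤ.+ 1ℤ ≡ i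
[i-1]+1≡i = solve-∀

[i+1]-1≡i : ∀ i → (i ℤ.+ 1ℤ) ℤ.- 1ℤ ≡ i
[i+1]-1≡i = solve-∀

side : V → Bool
side (_ , _ , s) = s

residue : V → ℤ/3
residue (i , j , _) = mod3 (i ℤ.- j)

data Direction : Set where
  δ₀ δ₁ δ₂ : Direction

neighbour : V → Direction → V
neighbour (i , j , true)  δ₀ = i , j , false
neighbour (i , j , true)  δ₁ = i ℤ.- 1ℤ , j , false
neighbour (i , j , true)  δ₂ = i , j ℤ.- 1ℤ , false
neighbour (i , j , false) δ₀ = i , j , true
neighbour (i , j , false) δ₁ = i ℤ.+ 1ℤ , j , true
neighbour (i , j , false) δ₂ = i , j ℤ.+ 1ℤ , true

neighbour-adj : ∀ v d → Adj v (neighbour v d)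
neighbour-adj (i , j , true)  δ₀ = inj₁ (e₀ i j)
neighbour-adj (i , j , true)  δ₁ = inj₁ (e₁ i j)
neighbour-adj (i , j , true)  δ₂ = inj₁ (e₂ i j)
neighbour-adj (i , j , false) δ₀ = inj₂ (e₀ i j)
neighbour-adj (i , j , false) δ₁ =
  inj₂ (subst (λ x → HexEdge (i ℤ.+ 1ℤ , j , true) (x , j , false)) ([i+1]-1≡i i) (e₁ (i ℤ.+ 1ℤ) j))
neighbour-adj (i , j , false) δ₂ =
  inj₂ (subst (λ y → HexEdge (i , j ℤ.+ 1ℤ , true) (i , y , false)) ([i+1]-1≡i j) (e₂ i (j ℤ.+ 1ℤ)))

adj⇒neighbour : ∀ {v u} → Adj v u → ∃ λ d → u ≡ neighbour v d
adj⇒neighbour (inj₁ (e₀ i j)) = δ₀ , refl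
adj⇒neighbour (inj₁ (e₁ i j)) = δ₁ , refl
adj⇒neighbour (inj₁ (e₂ i j)) = δ₂ , refl
adj⇒neighbour (inj₂ (e₀ i j)) = δ₀ , refl
adj⇒neighbour (inj₂ (e₁ i j)) = δ₁ , cong (λ x → x , j , true) (sym ([i-1]+1≡i i))
adj⇒neighbour (inj₂ (e₂ i j)) = δ₂ , cong (λ y → i , y , true) (sym ([i-1]+1≡i j))

side-neighbour : ∀ v d → side (neighbour v d) ≡ not (side v)
side-neighbour (_ , _ , true)  δ₀ = refl
side-neighbour (_ , _ , true)  δ₁ = refl
side-neighbour (_ , _ , true)  δ₂ = refl
side-neighbour (_ , _ , false) δ₀ = refl
side-neighbour (_ , _ , false) δ₁ = refl
side-neighbour (_ , _ , false) δ₂ = refl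

shift : Bool → Direction → ℤ/3 → ℤ/3
shift _     δ₀ ρ = ρ
shift true  δ₁ ρ = pred₃ ρ
shift true  δ₂ ρ = suc₃ ρ
shift false δ₁ ρ = suc₃ ρ
shift false δ₂ ρ = pred₃ ρ

residue-neighbour : ∀ v d → residue (neighbour v d) ≡ shift (side v) d (residue v)
residue-neighbour (i , j , true)  δ₀ = refl
residue-neighbour (i , j , true)  δ₁ =
  trans (cong mod3 ([i-1]-j≡[i-j]-1 i j)) (mod3[x-1]≡pred₃ (i ℤ.- j))
residue-neighbour (i , j , true)  δ₂ =
  trans (cong mod3 (i-[j-1]≡[i-j]+1 i j)) (mod3[x+1]≡suc₃ (i ℤ.- j))
residue-neighbour (i , j , false) δ₀ = refl
residue-neighbour (i , j , false) δ₁ =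
  trans (cong mod3 ([i+1]-j≡[i-j]+1 i j)) (mod3[x+1]≡suc₃ (i ℤ.- j))
residue-neighbour (i , j , false) δ₂ =
  trans (cong mod3 (i-[j+1]≡[i-j]-1 i j)) (mod3[x-1]≡pred₃ (i ℤ.- j))

shift-injective : ∀ s ρ {d d'} → shift s d ρ ≡ shift s d' ρ → d ≡ d'
shift-injective _     _ {δ₀} {δ₀} _ = refl
shift-injective _     _ {δ₁} {δ₁} _ = refl
shift-injective _     _ {δ₂} {δ₂} _ = refl
shift-injective true  ρ {δ₀} {δ₁} eq = ⊥-elim (pred₃≢id ρ (sym eq))
shift-injective true  ρ {δ₀} {δ₂} eq = ⊥-elim (suc₃≢id ρ (sym eq))
shift-injective true  ρ {δ₁} {δ₀} eq = ⊥-elim (pred₃≢id ρ eq)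
shift-injective true  ρ {δ₁} {δ₂} eq = ⊥-elim (suc₃≢pred₃ ρ (sym eq))
shift-injective true  ρ {δ₂} {δ₀} eq = ⊥-elim (suc₃≢id ρ eq)
shift-injective true  ρ {δ₂} {δ₁} eq = ⊥-elim (suc₃≢pred₃ ρ eq)
shift-injective false ρ {δ₀} {δ₁} eq = ⊥-elim (suc₃≢id ρ (sym eq))
shift-injective false ρ {δ₀} {δ₂} eq = ⊥-elim (pred₃≢id ρ (sym eq))
shift-injective false ρ {δ₁} {δ₀} eq = ⊥-elim (suc₃≢id ρ eq)
shift-injective false ρ {δ₁} {δ₂} eq = ⊥-elim (suc₃≢pred₃ ρ eq)
shift-injective false ρ {δ₂} {δ₀} eq = ⊥-elim (pred₃≢id ρ eq)
shift-injective false ρ {δ₂} {δ₁} eq = ⊥-elim (suc₃≢pred₃ ρ (sym eq))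

neighbour-injective : ∀ v {d d'} → neighbour v d ≡ neighbour v d' → d ≡ d'
neighbour-injective v {d} {d'} eq = shift-injective (side v) (residue v) (begin
  shift (side v) d (residue v)   ≡⟨ residue-neighbour v d ⟨
  residue (neighbour v d)        ≡⟨ cong residue eq ⟩
  residue (neighbour v d')       ≡⟨ residue-neighbour v d' ⟩
  shift (side v) d' (residue v)  ∎)

Admissible : ℕ → ℕ → Set
Admissible a b = a ≢ b × ∣ a - b ∣ ≢ a × ∣ a - b ∣ ≢ b

admissible? : ∀ a b → Dec (Admissible a b)
admissible? a b = ¬? (a ≟ b) ×-dec ¬? (∣ a - b ∣ ≟ a) ×-dec ¬? (∣ a - b ∣ ≟ b)

AdmissibleEdge : ℕ → ℕ → ℕ → Set
AdmissibleEdge k a b = (1 ≤ ∣ a - b ∣ × ∣ a - b ∣ ≤ k) × Admissible a b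

admissibleEdge? : ∀ k a b → Dec (AdmissibleEdge k a b)
admissibleEdge? k a b = (1 ≤? ∣ a - b ∣ ×-dec ∣ a - b ∣ ≤? k) ×-dec admissible? a b

admissibleEdge-sym : ∀ {k a b} → AdmissibleEdge k a b → AdmissibleEdge k b a
admissibleEdge-sym {k} {a} {b} ((1≤ab , ab≤k) , a≢b , ab≢a , ab≢b) =
  ( (subst (1 ≤_) ab≡ba 1≤ab , subst (_≤ k) ab≡ba ab≤k)
  , ≢-sym a≢b , subst (_≢ b) ab≡ba ab≢b , subst (_≢ a) ab≡ba ab≢a )
  where ab≡ba = ∣-∣-comm a b

colour : Bool → ℤ/3 → ℕ
colour true  r₀ = 1
colour true  r₁ = 2
colour true  r₂ = 4
colour false r₀ = 5
colour false r₁ = 6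
colour false r₂ = 7

uncolour : ℕ → ℤ/3
uncolour 2 = r₁
uncolour 4 = r₂
uncolour 6 = r₁
uncolour 7 = r₂
uncolour _ = r₀

uncolour-colour : ∀ s ρ → uncolour (colour s ρ) ≡ ρ
uncolour-colour true  r₀ = refl
uncolour-colour true  r₁ = refl
uncolour-colour true  r₂ = refl
uncolour-colour false r₀ = refl
uncolour-colour false r₁ = refl
uncolour-colour false r₂ = refl

colour-injective : ∀ s {ρ σ} → colour s ρ ≡ colour s σ → ρ ≡ σ
colour-injective s {ρ} {σ} eq = begin
  ρ                      ≡⟨ uncolour-colour s ρ ⟨
  uncolour (colour s ρ)  ≡⟨ cong uncolour eq ⟩
  uncolour (colour s σ)  ≡⟨ uncolour-colour s σ ⟩
  σ                      ∎

colour-edge : ∀ ρ σ → AdmissibleEdge 7 (colour true ρ) (colour false σ)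
colour-edge r₀ r₀ = from-yes (admissibleEdge? 7 1 5)
colour-edge r₀ r₁ = from-yes (admissibleEdge? 7 1 6)
colour-edge r₀ r₂ = from-yes (admissibleEdge? 7 1 7)
colour-edge r₁ r₀ = from-yes (admissibleEdge? 7 2 5)
colour-edge r₁ r₁ = from-yes (admissibleEdge? 7 2 6)
colour-edge r₁ r₂ = from-yes (admissibleEdge? 7 2 7)
colour-edge r₂ r₀ = from-yes (admissibleEdge? 7 4 5)
colour-edge r₂ r₁ = from-yes (admissibleEdge? 7 4 6)
colour-edge r₂ r₂ = from-yes (admissibleEdge? 7 4 7)

colour-true≤4 : ∀ ρ → colour true ρ ≤ 4
colour-true≤4 r₀ = from-yes (1 ≤? 4)
colour-true≤4 r₁ = from-yes (2 ≤? 4)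
colour-true≤4 r₂ = from-yes (4 ≤? 4)

5≤colour-false : ∀ σ → 5 ≤ colour false σ
5≤colour-false r₀ = from-yes (5 ≤? 5)
5≤colour-false r₁ = from-yes (5 ≤? 6)
5≤colour-false r₂ = from-yes (5 ≤? 7)

colour-true≤colour-false : ∀ ρ σ → colour true ρ ≤ colour false σ
colour-true≤colour-false ρ σ = ≤-trans (m≤n⇒m≤1+n (colour-true≤4 ρ)) (5≤colour-false σ)

-- The labels of one side all lie on the same side of any label of the other side.
colour-difference-injective : ∀ s ρ {σ τ} →
  ∣ colour s ρ - colour (not s) σ ∣ ≡ ∣ colour s ρ - colour (not s) τ ∣ → σ ≡ τ
colour-difference-injective true  ρ {σ} {τ} eq = colour-injective false
  (∣-∣-injectiveʳ-≥ (colour-true≤colour-false ρ σ) (colour-true≤colour-false ρ τ) eq)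
colour-difference-injective false ρ {σ} {τ} eq = colour-injective true
  (∣-∣-injectiveʳ-≤ (colour-true≤colour-false σ ρ) (colour-true≤colour-false τ ρ) eq)

label : V → ℕ
label v = colour (side v) (residue v)

label-hexEdge : ∀ {u v} → HexEdge u v → AdmissibleEdge 7 (label u) (label v)
label-hexEdge (e₀ i j) = colour-edge _ _
label-hexEdge (e₁ i j) = colour-edge _ _
label-hexEdge (e₂ i j) = colour-edge _ _

label-adj : ∀ {u v} → Adj u v → AdmissibleEdge 7 (label u) (label v)
label-adj (inj₁ e) = label-hexEdge e
label-adj (inj₂ e) = admissibleEdge-sym (label-hexEdge e)

label-neighbour : ∀ v d →
  label (neighbour v d) ≡ colour (not (side v)) (shift (side v) d (residue v))
label-neighbour v d = cong₂ colour (side-neighbour v d) (residue-neighbour v d)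

label-differences-injective : ∀ v {d d'} →
  ∣ label v - label (neighbour v d) ∣ ≡ ∣ label v - label (neighbour v d') ∣ → d ≡ d'
label-differences-injective v {d} {d'} eq
  rewrite label-neighbour v d | label-neighbour v d' =
  shift-injective (side v) (residue v) (colour-difference-injective (side v) (residue v) eq)

label-proper : IsProperTDL 7 label
label-proper = record
  { vertex-range = λ v → colour-range (side v) (residue v)
  ; edge-range   = λ u v uv → proj₁ (label-adj uv)
  ; adj-vertices = λ u v uv → proj₁ (proj₂ (label-adj uv))
  ; adj-edges    = adj-edges
  ; edge-vs-end  = λ u v uv → proj₂ (proj₂ (label-adj uv))
  }
  where
  colour-range : ∀ s ρ → 1 ≤ colour s ρ × colour s ρ ≤ 7
  colour-range true  r₀ = from-yes (1 ≤? 1 ×-dec 1 ≤? 7)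
  colour-range true  r₁ = from-yes (1 ≤? 2 ×-dec 2 ≤? 7)
  colour-range true  r₂ = from-yes (1 ≤? 4 ×-dec 4 ≤? 7)
  colour-range false r₀ = from-yes (1 ≤? 5 ×-dec 5 ≤? 7)
  colour-range false r₁ = from-yes (1 ≤? 6 ×-dec 6 ≤? 7)
  colour-range false r₂ = from-yes (1 ≤? 7 ×-dec 7 ≤? 7)
  adj-edges : ∀ v u w → Adj v u → Adj v w → u ≢ w →
              ∣ label v - label u ∣ ≢ ∣ label v - label w ∣
  adj-edges v u w vu vw u≢w with adj⇒neighbour vu | adj⇒neighbour vw
  ... | d , refl | d' , refl = λ eq → u≢w (cong (neighbour v) (label-differences-injective v eq))

Star : List ℕ → ℕ → ℕ → ℕ → ℕ → Set
Star L a x y z =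
  (x ∉ L × y ∉ L × z ∉ L) ×
  (Admissible a x × Admissible a y × Admissible a z) ×
  (∣ a - x ∣ ≢ ∣ a - y ∣ × ∣ a - x ∣ ≢ ∣ a - z ∣ × ∣ a - y ∣ ≢ ∣ a - z ∣)

star? : ∀ L a x y z → Dec (Star L a x y z)
star? L a x y z =
  (¬? (x ∈? L) ×-dec ¬? (y ∈? L) ×-dec ¬? (z ∈? L)) ×-dec
  (admissible? a x ×-dec admissible? a y ×-dec admissible? a z) ×-dec
  (¬? (∣ a - x ∣ ≟ ∣ a - y ∣) ×-dec ¬? (∣ a - x ∣ ≟ ∣ a - z ∣) ×-dec ¬? (∣ a - y ∣ ≟ ∣ a - z ∣))

NoStar : ℕ → List ℕ → ℕ → Set
NoStar n L a =
  All (λ x → All (λ y → All (λ z → ¬ Star L a x y z) (upTo n)) (upTo n)) (upTo n)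

noStar? : ∀ n L a → Dec (NoStar n L a)
noStar? n L a =
  all? (λ x → all? (λ y → all? (λ z → ¬? (star? L a x y z)) (upTo n)) (upTo n)) (upTo n)

-- Labels below n that can be ruled out one by one, from the end of the list to its head.
EliminationOrder : ℕ → List ℕ → Set
EliminationOrder n []      = ⊤
EliminationOrder n (a ∷ L) = NoStar n L a × EliminationOrder n L

eliminationOrder? : ∀ n L → Dec (EliminationOrder n L)
eliminationOrder? n []      = yes tt
eliminationOrder? n (a ∷ L) = noStar? n L a ×-dec eliminationOrder? n L

module _ {k} {f : V → ℕ} (P : IsProperTDL k f) where
  open IsProperTDL P

  star-at : ∀ L v → (∀ u → f u ∉ L) →
            Star L (f v) (f (neighbour v δ₀)) (f (neighbour v δ₁)) (f (neighbour v δ₂))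
  star-at L v avoids-L =
    (avoids-L _ , avoids-L _ , avoids-L _) ,
    (admissible δ₀ , admissible δ₁ , admissible δ₂) ,
    (differ (λ ()) , differ (λ ()) , differ (λ ()))
    where
    admissible : ∀ d → Admissible (f v) (f (neighbour v d))
    admissible d = adj-vertices _ _ (neighbour-adj v d) , edge-vs-end _ _ (neighbour-adj v d)
    differ : ∀ {d d'} → d ≢ d' → ∣ f v - f (neighbour v d) ∣ ≢ ∣ f v - f (neighbour v d') ∣
    differ {d} {d'} d≢d' = adj-edges v _ _ (neighbour-adj v d) (neighbour-adj v d')
                             (λ eq → d≢d' (neighbour-injective v eq))

  module _ {n} (k<n : k < n) where

    label∈upTo : ∀ v → f v ∈ upTo n
    label∈upTo v = ∈-upTo⁺ (≤-<-trans (proj₂ (vertex-range v)) k<n)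

    eliminated : ∀ L → EliminationOrder n L → ∀ v → f v ∉ L
    eliminated []      _ _ ()
    eliminated (a ∷ L) (no-star , order) v (here refl) =
      All.lookup (All.lookup (All.lookup no-star (label∈upTo _)) (label∈upTo _)) (label∈upTo _)
        (star-at L v (eliminated L order))
    eliminated (a ∷ L) (_ , order) v (there f[v]∈L) = eliminated L order v f[v]∈L

    no-labelling : ∀ L → EliminationOrder n L → All (_∈ L) (upTo n) → ⊥
    no-labelling L order covers = eliminated L order v (All.lookup covers (label∈upTo v))
      where v = 0ℤ , 0ℤ , true

elimination-order : List ℕ
elimination-order = 6 ∷ 4 ∷ 1 ∷ 5 ∷ 2 ∷ 3 ∷ 0 ∷ []

mainTheorem3 : χtd-Hex≡ 7
mainTheorem3 = (label , label-proper) , λ k k<7 (f , P) →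
  no-labelling P k<7 elimination-order
    (from-yes (eliminationOrder? 7 elimination-order))
    (from-yes (all? (_∈? elimination-order) (upTo 7)))
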